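{- For any $\varepsilon>0$, any deterministic algorithm that approximates the cost of graphic TSP or of $(1,2)$-TSP on $n$ points to within a factor of $2-\varepsilon$ using distance queries needs $\Omega(\varepsilon n^2)$ queries.
   Context: Graphic TSP: connected unweighted undirected $n$-vertex graph with shortest-path metric; $(1,2)$-TSP: $n$-point metric with distances in $\{1,2\}$; in both, the cost is the minimum total length of a Hamiltonian cycle on all points. A distance query on $(u,v)$ returns $d(u,v)$.
   Formalization: The parameter ε ranges over the positive rationals, and the algorithms considered output only rational estimates of the tour cost. -}

module Defs where

open import Data.Nat as ℕ using (ℕ; zero; suc; _<?_)
open import Data.Fin using (Fin; zero; suc; toℕ; fromℕ<)
open import Data.Fin.Permutation using (Permutation′; _⟨$⟩ʳ_)
open import Data.Bool using (Bool; true; false)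
open import Data.Integer using (+_)
open import Data.Rational using (ℚ; _/_; _≤_; _<_; _*_; _-_)
open import Data.Product using (Σ; ∃; _×_)
open import Data.Sum using (_⊎_)
open import Relation.Nullary using (yes; no; ¬_)
open import Relation.Binary.PropositionalEquality using (_≡_)

ℕ→ℚ : ℕ → ℚ
ℕ→ℚ k = + k / 1

Dist : ℕ → Set
Dist n = Fin n → Fin n → ℕ

cyc : ∀ {n} → Fin n → Fin n
cyc {suc m} i with suc (toℕ i) <? suc m
... | yes p = fromℕ< p
... | no _  = zero

sumFin : ∀ n → (Fin n → ℕ) → ℕ
sumFin zero    f = 0
sumFin (suc n) f = f zero ℕ.+ sumFin n (λ i → f (suc i))

tourLength : ∀ {n} → Dist n → Permutation′ n → ℕ
tourLength {n} d π = sumFin n (λ i → d (π ⟨$⟩ʳ i) (π ⟨$⟩ʳ cyc i))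

IsTSPCost : ∀ {n} → Dist n → ℕ → Set
IsTSPCost {n} d c =
  (∃ λ (π : Permutation′ n) → tourLength d π ≡ c) ×
  (∀ (π : Permutation′ n) → c ℕ.≤ tourLength d π)

data Walk {n} (E : Fin n → Fin n → Bool) : Fin n → Fin n → ℕ → Set where
  here : ∀ {u} → Walk E u u 0
  step : ∀ {u w v k} → E u w ≡ true → Walk E w v k → Walk E u v (suc k)

-- d is the shortest-path metric of a connected, unweighted, undirected
-- (simple) graph on vertex set Fin n.  Connectivity is implied by the
-- existence of a walk of length d u v between every pair u, v.
IsGraphicMetric : ∀ {n} → Dist n → Set
IsGraphicMetric {n} d = Σ (Fin n → Fin n → Bool) λ E →
  (∀ u v → E u v ≡ E v u) ×
  (∀ u → E u u ≡ false) ×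
  (∀ u v → Walk E u v (d u v) × (∀ k → Walk E u v k → d u v ℕ.≤ k))

Is12Metric : ∀ {n} → Dist n → Set
Is12Metric {n} d =
  (∀ u → d u u ≡ 0) ×
  (∀ u v → d u v ≡ d v u) ×
  (∀ u v → ¬ u ≡ v → d u v ≡ 1 ⊎ d u v ≡ 2)

-- Deterministic (adaptive) query algorithms on n points: a decision
-- tree whose internal nodes query d(u,v) and branch on the answer and
-- whose leaves output an estimate of the TSP cost.

data QueryAlg (n : ℕ) : Set where
  output : ℚ → QueryAlg n
  query  : Fin n → Fin n → (ℕ → QueryAlg n) → QueryAlg n

run : ∀ {n} → QueryAlg n → Dist n → ℚ
run (output x)    d = x
run (query u v k) d = run (k (d u v)) d

queries : ∀ {n} → QueryAlg n → Dist n → ℕ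
queries (output x)    d = 0
queries (query u v k) d = suc (queries (k (d u v)) d)

Approximates : ∀ {n} → (Dist n → Set) → ℚ → QueryAlg n → Set
Approximates {n} P α A = ∀ (d : Dist n) → P d → ∀ c → IsTSPCost d c →
  (ℕ→ℚ c ≤ run A d) × (run A d ≤ α * ℕ→ℚ c)

QueryLowerBound : (∀ {n} → Dist n → Set) → Set
QueryLowerBound P =
  Σ ℚ λ κ → (ℕ→ℚ 0 < κ) × (∀ (ε : ℚ) → ℕ→ℚ 0 < ε →
    ∃ λ (n₀ : ℕ) → ∀ n → n₀ ℕ.≤ n → ∀ (A : QueryAlg n) →
      Approximates P (ℕ→ℚ 2 - ε) A →
      ∃ λ (d : Dist n) → P d × (κ * ε * ℕ→ℚ (n ℕ.* n) ≤ ℕ→ℚ (queries A d)))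

module Submission where

-- Both problem classes contain the hub metrics: a hub at distance 1 from
-- every point, any other pair at distance 1 or 2 according to a "heavy"
-- relation.  Run a deterministic algorithm A on the star metric (every
-- pair heavy), where every tour costs at least 2n - 2.  The fooling metric
-- makes heavy only the q pairs that A queried, so A gives the same answer
-- on it.  Its cost is at least n and, averaging over the m = ⌊n/2⌋
-- rotations of Walecki's zigzag tour, at most n + 1 + 2q/m: the path steps
-- of these tours are pairwise distinct pairs, so all of them together pay
-- for each query at most twice.  A (2 - ε)-approximation must then satisfy
-- 2n - 2 ≤ (2 - ε)(n + 1 + 2q/m), which for ε = P/R and n ≥ 8R + 2 forces
-- q ≥ ε n² / 16.

open import Defs

open import Data.Nat as ℕ using (ℕ; zero; suc; _+_; _*_; _∸_; _≤_; _<_; z≤n; s≤s; _<?_; _≤?_; _≟_; _≡ᵇ_)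
open import Data.Nat.Properties
open import Data.Nat.DivMod
open import Data.Nat.Divisibility using (n∣m*n)
open import Data.Nat.Tactic.RingSolver using (solve-∀)
open import Data.Fin as F using (Fin; toℕ; fromℕ<)
open import Data.Fin.Properties as FP using (toℕ-fromℕ<; toℕ-injective; toℕ<n)
open import Data.Fin.Permutation using (Permutation′; _⟨$⟩ʳ_; _⟨$⟩ˡ_; inverseˡ; permutation; _∘ₚ_)
import Data.Fin.Permutation as Perm
open import Algebra.Properties.CommutativeMonoid.Sum +-0-commutativeMonoid
  using (sum-syntax; ∑-distrib-+; ∑-comm; sum-cong-≗; sum-replicate-zero)
open import Data.Bool using (Bool; true; false; _∨_; T)
open import Data.Bool.Properties using (∨-comm)
open import Data.List using (List; []; _∷_; length; lookup)
open import Data.List.Membership.Propositional using (_∈_)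
import Data.List.Relation.Unary.Any as Any
open import Data.List.Relation.Unary.Any.Properties using (lookup-index)
import Data.Integer as ℤ
import Data.Integer.Properties as ℤP
import Data.Integer.Tactic.RingSolver as ℤ-Solver
open import Data.Rational as Q using (ℚ; mkℚ; toℚᵘ)
open import Data.Rational.Properties
  using (toℚᵘ-mono-≤; toℚᵘ-mono-<; toℚᵘ-homo-*; toℚᵘ-homo-+; toℚᵘ-homo‿-; toℚᵘ-fromℚᵘ)
import Data.Rational.Properties as ℚP
open import Data.Rational.Unnormalised as U using (mkℚᵘ; *≤*; *<*)
import Data.Rational.Unnormalised.Properties as UP
open import Data.Nat.Coprimality using (Coprime)
open import Data.Product using (Σ; ∃; _×_; _,_; proj₁; proj₂)
open import Data.Product.Properties using (≡-dec)
open import Data.Sum using (_⊎_; inj₁; inj₂; [_,_]′)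
open import Data.Empty using (⊥; ⊥-elim)
open import Function using (_∘_; case_of_)
open import Relation.Nullary using (¬_; Dec; yes; no; does; contradiction)
open import Relation.Nullary.Decidable using (dec-true; _×-dec_; _⊎-dec_; decidable-stable)
open import Relation.Binary using (DecidableEquality)
open import Relation.Binary.PropositionalEquality

private
  variable
    A B : Set
    n : ℕ

𝟙 : Dec A → ℕ
𝟙 (yes _) = 1
𝟙 (no _)  = 0

𝟙≤1 : (a? : Dec A) → 𝟙 a? ≤ 1
𝟙≤1 (yes _) = ≤-refl
𝟙≤1 (no _)  = z≤n

𝟙-yes : (a? : Dec A) → A → 𝟙 a? ≡ 1
𝟙-yes (yes _) _ = refl
𝟙-yes (no ¬a) a = contradiction a ¬a

𝟙-pos : (a? : Dec A) → 0 < 𝟙 a? → A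
𝟙-pos (yes a) _ = a

𝟙-⊎ : {C : Set} (c? : Dec C) (a? : Dec A) (b? : Dec B) → (C → A ⊎ B) → 𝟙 c? ≤ 𝟙 a? + 𝟙 b?
𝟙-⊎ (no _)  a? b? split = z≤n
𝟙-⊎ (yes c) a? b? split with split c
... | inj₁ a = ≤-trans (≤-reflexive (sym (𝟙-yes a? a))) (m≤m+n _ _)
... | inj₂ b = ≤-trans (≤-reflexive (sym (𝟙-yes b? b))) (m≤n+m _ _)

sumFin≡∑ : ∀ n (f : Fin n → ℕ) → sumFin n f ≡ ∑[ i < n ] f i
sumFin≡∑ zero    f = refl
sumFin≡∑ (suc n) f = cong (f F.zero +_) (sumFin≡∑ n (f ∘ F.suc))

∑-mono : (f g : Fin n → ℕ) → (∀ i → f i ≤ g i) → ∑[ i < n ] f i ≤ ∑[ i < n ] g i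
∑-mono {zero}  f g f≤g = z≤n
∑-mono {suc n} f g f≤g = +-mono-≤ (f≤g F.zero) (∑-mono (f ∘ F.suc) (g ∘ F.suc) (f≤g ∘ F.suc))

∑-const : ∀ n c → ∑[ i < n ] c ≡ n * c
∑-const zero    c = refl
∑-const (suc n) c = cong (c +_) (∑-const n c)

∑-pos : (f : Fin n → ℕ) → 0 < ∑[ i < n ] f i → ∃ λ i → 0 < f i
∑-pos {suc n} f pos with 0 <? f F.zero
... | yes f₀>0 = F.zero , f₀>0
... | no  f₀≯0 = let (i , fᵢ>0) = ∑-pos (f ∘ F.suc) rest>0 in F.suc i , fᵢ>0
  where
  rest>0 : 0 < ∑[ i < n ] f (F.suc i)
  rest>0 = subst (λ x → 0 < x + ∑[ i < n ] f (F.suc i)) (n≤0⇒n≡0 (≮⇒≥ f₀≯0)) pos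

∑-zero : (f : Fin n → ℕ) → (∀ i → f i ≡ 0) → ∑[ i < n ] f i ≡ 0
∑-zero {n} f f≡0 = trans (sum-cong-≗ f≡0) (sum-replicate-zero n)

term≤∑ : (f : Fin n → ℕ) (i : Fin n) → f i ≤ ∑[ k < n ] f k
term≤∑ f F.zero    = m≤m+n _ _
term≤∑ f (F.suc i) = ≤-trans (term≤∑ (f ∘ F.suc) i) (m≤n+m _ _)

∑-at-most-one : ∀ (f : Fin n → ℕ) c → (∀ i → f i ≤ c) →
  (∀ i k → 0 < f i → 0 < f k → i ≡ k) → ∑[ i < n ] f i ≤ c
∑-at-most-one {zero}  f c bound unique = z≤n
∑-at-most-one {suc n} f c bound unique with 0 <? f F.zero
... | no  f₀≯0 = +-mono-≤ (≮⇒≥ f₀≯0) (∑-at-most-one (f ∘ F.suc) c (bound ∘ F.suc)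
                   (λ i k p q → FP.suc-injective (unique (F.suc i) (F.suc k) p q)))
... | yes f₀>0 = begin
  f F.zero + ∑[ i < n ] f (F.suc i)  ≡⟨ cong (f F.zero +_) (∑-zero (f ∘ F.suc) rest≡0) ⟩
  f F.zero + 0                       ≡⟨ +-identityʳ _ ⟩
  f F.zero                           ≤⟨ bound F.zero ⟩
  c                                  ∎
  where
  open ≤-Reasoning
  rest≡0 : ∀ i → f (F.suc i) ≡ 0
  rest≡0 i = n≤0⇒n≡0 (≮⇒≥ λ pos → case unique F.zero (F.suc i) f₀>0 pos of λ ())

hits-once : (f : Fin n → Fin n) → (∀ {i k} → f i ≡ f k → i ≡ k) →
  ∀ a → ∑[ i < n ] 𝟙 (f i F.≟ a) ≤ 1
hits-once f injective a = ∑-at-most-one _ 1 (λ i → 𝟙≤1 (f i F.≟ a))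
  λ i k p q → injective (trans (𝟙-pos (f i F.≟ a) p) (sym (𝟙-pos (f k F.≟ a) q)))

toℕ-cyc : (i : Fin n) → suc (toℕ i) < n → toℕ (cyc i) ≡ suc (toℕ i)
toℕ-cyc {suc n} i i+1<n with suc (toℕ i) <? suc n
... | yes p = toℕ-fromℕ< p
... | no ¬p = contradiction i+1<n ¬p

toℕ-cyc-last : (i : Fin n) → ¬ suc (toℕ i) < n → toℕ (cyc i) ≡ 0
toℕ-cyc-last {suc n} i i+1≮n with suc (toℕ i) <? suc n
... | yes p = contradiction p i+1≮n
... | no _  = refl

last-position : (i : Fin n) → ¬ suc (toℕ i) < n → suc (toℕ i) ≡ n
last-position i i+1≮n = ≤-antisym (toℕ<n i) (≮⇒≥ i+1≮n)

cyc-injective : {i k : Fin n} → cyc i ≡ cyc k → i ≡ k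
cyc-injective {n} {i} {k} eq with suc (toℕ i) <? n | suc (toℕ k) <? n
... | yes p | yes q = toℕ-injective (suc-injective
                        (trans (sym (toℕ-cyc i p)) (trans (cong toℕ eq) (toℕ-cyc k q))))
... | yes p | no q  = contradiction
                        (trans (sym (toℕ-cyc i p)) (trans (cong toℕ eq) (toℕ-cyc-last k q))) λ ()
... | no p  | yes q = contradiction
                        (trans (sym (toℕ-cyc k q)) (trans (cong toℕ (sym eq)) (toℕ-cyc-last i p))) λ ()
... | no p  | no q  = toℕ-injective (suc-injective (trans (last-position i p) (sym (last-position k q))))

cyc-moves : 2 ≤ n → (i : Fin n) → cyc i ≢ i
cyc-moves {n} 2≤n i eq with suc (toℕ i) <? n
... | yes p = 1+n≢n (trans (sym (toℕ-cyc i p)) (cong toℕ eq))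
... | no p  = <-irrefl refl (begin-strict
  1           <⟨ 2≤n ⟩
  n           ≡⟨ sym (last-position i p) ⟩
  suc (toℕ i) ≡⟨ cong suc (trans (sym (cong toℕ eq)) (toℕ-cyc-last i p)) ⟩
  1           ∎)
  where open ≤-Reasoning

perm-injective : (π : Permutation′ n) {i k : Fin n} → π ⟨$⟩ʳ i ≡ π ⟨$⟩ʳ k → i ≡ k
perm-injective π {i} {k} eq = trans (sym (inverseˡ π)) (trans (cong (π ⟨$⟩ˡ_) eq) (inverseˡ π))

tourLength≡∑ : (d : Dist n) (π : Permutation′ n) →
  tourLength d π ≡ ∑[ t < n ] d (π ⟨$⟩ʳ t) (π ⟨$⟩ʳ cyc t)
tourLength≡∑ {n} d π = sumFin≡∑ n _

step-distinct : 2 ≤ n → (π : Permutation′ n) (t : Fin n) → π ⟨$⟩ʳ t ≢ π ⟨$⟩ʳ cyc t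
step-distinct 2≤n π t eq = cyc-moves 2≤n t (sym (perm-injective π eq))

leaves-once : (π : Permutation′ n) (a : Fin n) → ∑[ t < n ] 𝟙 (π ⟨$⟩ʳ t F.≟ a) ≤ 1
leaves-once π = hits-once (π ⟨$⟩ʳ_) (perm-injective π)

enters-once : (π : Permutation′ n) (a : Fin n) → ∑[ t < n ] 𝟙 (π ⟨$⟩ʳ cyc t F.≟ a) ≤ 1
enters-once π = hits-once (λ t → π ⟨$⟩ʳ cyc t) (cyc-injective ∘ perm-injective π)

tour-≥n : 2 ≤ n → (d : Dist n) → (∀ u v → u ≢ v → 1 ≤ d u v) →
  (π : Permutation′ n) → n ≤ tourLength d π
tour-≥n {n} 2≤n d d≥1 π = begin
  n                                       ≡⟨ sym (trans (∑-const n 1) (*-identityʳ n)) ⟩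
  ∑[ t < n ] 1                            ≤⟨ ∑-mono _ _ (λ t → d≥1 _ _ (step-distinct 2≤n π t)) ⟩
  ∑[ t < n ] d (π ⟨$⟩ʳ t) (π ⟨$⟩ʳ cyc t)  ≡⟨ sym (tourLength≡∑ d π) ⟩
  tourLength d π                          ∎
  where open ≤-Reasoning

-- Every ℕ-valued function on an inhabited type has a minimiser.
-- Constructively only the double negation holds; that suffices here
-- because it is only used to derive a contradiction.
minimiser : {X : Set} (f : X → ℕ) → X → ¬ ¬ (Σ X λ x → ∀ y → f x ≤ f y)
minimiser {X} f x₀ none = noneBelow (suc (f x₀)) x₀ ≤-refl
  where
  noneBelow : ∀ k x → f x < k → ⊥
  noneBelow (suc k) x fx<1+k = none (x , minimal)
    where
    minimal : ∀ y → f x ≤ f y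
    minimal y with f x ≤? f y
    ... | yes fx≤fy = fx≤fy
    ... | no  fx≰fy = ⊥-elim (noneBelow k y (<-≤-trans (≰⇒> fx≰fy) (ℕ.s≤s⁻¹ fx<1+k)))

tsp-cost-exists : (d : Dist n) → ¬ ¬ (∃ λ c → IsTSPCost d c)
tsp-cost-exists d no-cost = minimiser (tourLength d) Perm.id
  λ (π , minimal) → no-cost (tourLength d π , (π , refl) , minimal)

-- These are (1,2)-metrics and also graphic: the graph of
-- distance-1 pairs contains the star at h.

weight : Bool → ℕ
weight true  = 2
weight false = 1

module _ (h : Fin n) (heavy : Fin n → Fin n → Bool) where

  hubMetric : Dist n
  hubMetric u v with u F.≟ v | u F.≟ h | v F.≟ h
  ... | yes _ | _     | _     = 0
  ... | no _  | yes _ | _     = 1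
  ... | no _  | no _  | yes _ = 1
  ... | no _  | no _  | no _  = weight (heavy u v ∨ heavy v u)

  hubMetric-diag : ∀ u → hubMetric u u ≡ 0
  hubMetric-diag u with u F.≟ u
  ... | yes _  = refl
  ... | no u≢u = contradiction refl u≢u

  hubMetric-sym : ∀ u v → hubMetric u v ≡ hubMetric v u
  hubMetric-sym u v with u F.≟ v | v F.≟ u | u F.≟ h | v F.≟ h
  ... | yes _   | yes _   | _     | _     = refl
  ... | yes u≡v | no v≢u  | _     | _     = contradiction (sym u≡v) v≢u
  ... | no u≢v  | yes v≡u | _     | _     = contradiction (sym v≡u) u≢v
  ... | no _    | no _    | yes _ | yes _ = refl
  ... | no _    | no _    | yes _ | no _  = refl
  ... | no _    | no _    | no _  | yes _ = refl
  ... | no _    | no _    | no _  | no _  = cong weight (∨-comm (heavy u v) (heavy v u))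

  hubMetric-1or2 : ∀ u v → u ≢ v → hubMetric u v ≡ 1 ⊎ hubMetric u v ≡ 2
  hubMetric-1or2 u v u≢v with u F.≟ v | u F.≟ h | v F.≟ h
  ... | yes u≡v | _     | _     = contradiction u≡v u≢v
  ... | no _    | yes _ | _     = inj₁ refl
  ... | no _    | no _  | yes _ = inj₁ refl
  ... | no _    | no _  | no _  with heavy u v ∨ heavy v u
  ...   | true  = inj₂ refl
  ...   | false = inj₁ refl

  hubMetric-is12 : Is12Metric hubMetric
  hubMetric-is12 = hubMetric-diag , hubMetric-sym , hubMetric-1or2

  hubMetric-≤2 : ∀ u v → hubMetric u v ≤ 2
  hubMetric-≤2 u v = case u F.≟ v of λ where
    (yes refl) → ≤-trans (≤-reflexive (hubMetric-diag u)) z≤n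
    (no u≢v)   → [ (λ d≡1 → ≤-trans (≤-reflexive d≡1) (s≤s z≤n)) , ≤-reflexive ]′
                   (hubMetric-1or2 u v u≢v)

  hubMetric-≥1 : ∀ u v → u ≢ v → 1 ≤ hubMetric u v
  hubMetric-≥1 u v u≢v with hubMetric-1or2 u v u≢v
  ... | inj₁ d≡1 = ≤-reflexive (sym d≡1)
  ... | inj₂ d≡2 = ≤-trans (s≤s z≤n) (≤-reflexive (sym d≡2))

  hubMetric-from-hub : ∀ v → v ≢ h → hubMetric h v ≡ 1
  hubMetric-from-hub v v≢h with h F.≟ v | h F.≟ h
  ... | yes h≡v | _      = contradiction (sym h≡v) v≢h
  ... | no _    | yes _  = refl
  ... | no _    | no h≢h = contradiction refl h≢h

  hubMetric-to-hub : ∀ u → u ≢ h → hubMetric u h ≡ 1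
  hubMetric-to-hub u u≢h = trans (hubMetric-sym u h) (hubMetric-from-hub u u≢h)

  hubMetric-2 : ∀ u v → hubMetric u v ≡ 2 →
    u ≢ h × v ≢ h × heavy u v ∨ heavy v u ≡ true
  hubMetric-2 u v with u F.≟ v | u F.≟ h | v F.≟ h
  ... | yes _ | _     | _       = λ ()
  ... | no _  | yes _ | _       = λ ()
  ... | no _  | no _  | yes _   = λ ()
  ... | no _  | no u≢h | no v≢h with heavy u v ∨ heavy v u
  ...   | true  = λ _ → u≢h , v≢h , refl
  ...   | false = λ ()

  -- The unit-distance graph; its shortest paths realise the hub metric
  -- (distance-2 pairs are joined through the hub).
  unitEdge : Fin n → Fin n → Bool
  unitEdge u v = hubMetric u v ≡ᵇ 1

  unitEdge-sound : ∀ u v → unitEdge u v ≡ true → hubMetric u v ≡ 1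
  unitEdge-sound u v e = ≡ᵇ⇒≡ (hubMetric u v) 1 (subst T (sym e) _)

  unitEdge-complete : ∀ u v → hubMetric u v ≡ 1 → unitEdge u v ≡ true
  unitEdge-complete u v d≡1 rewrite d≡1 = refl

  shortest-walk : ∀ u v → Walk unitEdge u v (hubMetric u v)
  shortest-walk u v = case u F.≟ v of λ
    { (yes refl) → subst (Walk unitEdge u u) (sym (hubMetric-diag u)) here
    ; (no u≢v)   → [ via-edge , via-hub ]′ (hubMetric-1or2 u v u≢v)
    }
    where
    via-edge : hubMetric u v ≡ 1 → Walk unitEdge u v (hubMetric u v)
    via-edge d≡1 = subst (Walk unitEdge u v) (sym d≡1) (step (unitEdge-complete u v d≡1) here)
    via-hub : hubMetric u v ≡ 2 → Walk unitEdge u v (hubMetric u v)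
    via-hub d≡2 with hubMetric-2 u v d≡2
    ... | u≢h , v≢h , _ = subst (Walk unitEdge u v) (sym d≡2)
      (step (unitEdge-complete u h (hubMetric-to-hub u u≢h))
      (step (unitEdge-complete h v (hubMetric-from-hub v v≢h)) here))

  walk-≥ : ∀ {u v k} → Walk unitEdge u v k → hubMetric u v ≤ k
  walk-≥ {u} here                   = ≤-reflexive (hubMetric-diag u)
  walk-≥ {u} {v} (step e here)       = ≤-reflexive (unitEdge-sound u v e)
  walk-≥ {u} {v} (step _ (step _ _)) = ≤-trans (hubMetric-≤2 u v) (s≤s (s≤s z≤n))

  hubMetric-isGraphic : IsGraphicMetric hubMetric
  hubMetric-isGraphic = unitEdge
    , (λ u v → cong (_≡ᵇ 1) (hubMetric-sym u v))
    , (λ u → cong (_≡ᵇ 1) (hubMetric-diag u))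
    , λ u v → shortest-walk u v , λ k → walk-≥

starMetric : Fin n → Dist n
starMetric h = hubMetric h (λ _ _ → true)

hubMetric-heavy : (h : Fin n) (heavy : Fin n → Fin n → Bool) → ∀ u v →
  heavy u v ≡ true → hubMetric h heavy u v ≡ starMetric h u v
hubMetric-heavy h heavy u v uv-heavy with u F.≟ v | u F.≟ h | v F.≟ h
... | yes _ | _     | _     = refl
... | no _  | yes _ | _     = refl
... | no _  | no _  | yes _ = refl
... | no _  | no _  | no _  rewrite uv-heavy = refl

star-step : (h u v : Fin n) → u ≢ v → 2 ≤ starMetric h u v + 𝟙 (u F.≟ h) + 𝟙 (v F.≟ h)
star-step h u v u≢v with u F.≟ v | u F.≟ h | v F.≟ h
... | yes u≡v | _     | _     = contradiction u≡v u≢v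
... | no _    | yes _ | _     = s≤s (s≤s z≤n)
... | no _    | no _  | yes _ = ≤-refl
... | no _    | no _  | no _  = ≤-refl

-- Every tour of the star metric has length at least 2n - 2: only the
-- two steps at the hub are cheap.
star-tour : 2 ≤ n → (h : Fin n) (π : Permutation′ n) → 2 * n ≤ tourLength (starMetric h) π + 2
star-tour {n} 2≤n h π = begin
  2 * n                                     ≡⟨ trans (*-comm 2 n) (sym (∑-const n 2)) ⟩
  ∑[ t < n ] 2                              ≤⟨ ∑-mono _ _ (λ t → star-step h _ _ (step-distinct 2≤n π t)) ⟩
  ∑[ t < n ] (cost t + leaves t + enters t) ≡⟨ ∑-distrib-+ (λ t → cost t + leaves t) enters ⟩
  ∑[ t < n ] (cost t + leaves t) + ∑[ t < n ] enters t
                                            ≡⟨ cong (_+ ∑[ t < n ] enters t) (∑-distrib-+ cost leaves) ⟩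
  ∑[ t < n ] cost t + ∑[ t < n ] leaves t + ∑[ t < n ] enters t
                                            ≤⟨ +-mono-≤ (+-monoʳ-≤ (∑[ t < n ] cost t) (leaves-once π h))
                                                        (enters-once π h) ⟩
  ∑[ t < n ] cost t + 1 + 1                 ≡⟨ cong (λ x → x + 1 + 1) (sym (tourLength≡∑ (starMetric h) π)) ⟩
  tourLength (starMetric h) π + 1 + 1       ≡⟨ +-assoc (tourLength (starMetric h) π) 1 1 ⟩
  tourLength (starMetric h) π + 2           ∎
  where
  open ≤-Reasoning
  cost leaves enters : Fin n → ℕ
  cost   t = starMetric h (π ⟨$⟩ʳ t) (π ⟨$⟩ʳ cyc t)
  leaves t = 𝟙 (π ⟨$⟩ʳ t F.≟ h)
  enters t = 𝟙 (π ⟨$⟩ʳ cyc t F.≟ h)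

transcript : QueryAlg n → Dist n → List (Fin n × Fin n)
transcript (output _)    d = []
transcript (query u v k) d = (u , v) ∷ transcript (k (d u v)) d

transcript-length : (A : QueryAlg n) (d : Dist n) → length (transcript A d) ≡ queries A d
transcript-length (output _)    d = refl
transcript-length (query u v k) d = cong suc (transcript-length (k (d u v)) d)

run-agree : (A : QueryAlg n) (d d′ : Dist n) →
  (∀ u v → (u , v) ∈ transcript A d → d′ u v ≡ d u v) → run A d′ ≡ run A d
run-agree (output _)    d d′ agree = refl
run-agree (query u v k) d d′ agree rewrite agree u v (Any.here refl) =
  run-agree (k (d u v)) d d′ (λ a b p → agree a b (Any.there p))

-- Run the algorithm on the star metric and make
-- heavy exactly the queried pairs: the algorithm cannot tell the two
-- metrics apart, yet the fooling metric has tours of length about n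
-- unless the queries are numerous.

_≟ₚ_ : DecidableEquality (Fin n × Fin n)
_≟ₚ_ = ≡-dec F._≟_ F._≟_

heavy : List (Fin n × Fin n) → Fin n → Fin n → Bool
heavy qs u v = does (Any.any? ((u , v) ≟ₚ_) qs)

fooling : Fin n → List (Fin n × Fin n) → Dist n
fooling h qs = hubMetric h (heavy qs)

fooling-agrees : (h : Fin n) (qs : List (Fin n × Fin n)) → ∀ u v →
  (u , v) ∈ qs → fooling h qs u v ≡ starMetric h u v
fooling-agrees h qs u v uv∈qs =
  hubMetric-heavy h (heavy qs) u v (dec-true (Any.any? ((u , v) ≟ₚ_) qs) uv∈qs)

Joins : Fin n × Fin n → Fin n → Fin n → Set
Joins e u v = e ≡ (u , v) ⊎ e ≡ (v , u)

joins? : (e : Fin n × Fin n) (u v : Fin n) → Dec (Joins e u v)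
joins? e u v = (e ≟ₚ (u , v)) ⊎-dec (e ≟ₚ (v , u))

fooling-2 : (h : Fin n) (qs : List (Fin n × Fin n)) → ∀ u v →
  fooling h qs u v ≡ 2 → ∃ λ k → Joins (lookup qs k) u v
fooling-2 h qs u v d≡2 = joined (proj₂ (proj₂ (hubMetric-2 h (heavy qs) u v d≡2)))
  where
  joined : heavy qs u v ∨ heavy qs v u ≡ true →
    ∃ λ k → Joins (lookup qs k) u v
  joined with Any.any? ((u , v) ≟ₚ_) qs | Any.any? ((v , u) ≟ₚ_) qs
  ... | yes p | _     = λ _ → Any.index p , inj₁ (sym (lookup-index p))
  ... | no _  | yes p = λ _ → Any.index p , inj₂ (sym (lookup-index p))
  ... | no _  | no _  = λ ()

Spends : Fin n × Fin n → Permutation′ n → Fin n → Set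
Spends {n} e π t = suc (toℕ t) < n × Joins e (π ⟨$⟩ʳ t) (π ⟨$⟩ʳ cyc t)

spends? : (e : Fin n × Fin n) (π : Permutation′ n) (t : Fin n) → Dec (Spends e π t)
spends? {n} e π t = (suc (toℕ t) <? n) ×-dec joins? e _ _

-- A tour spends any given query at most twice, since only the steps
-- leaving and entering its first point can join it.
spends-at-most-twice : (e : Fin n × Fin n) (π : Permutation′ n) →
  ∑[ t < n ] 𝟙 (spends? e π t) ≤ 2
spends-at-most-twice {n} (a , b) π = begin
  ∑[ t < n ] 𝟙 (spends? (a , b) π t)          ≤⟨ ∑-mono _ _ per-step ⟩
  ∑[ t < n ] (leaves t + enters t)            ≡⟨ ∑-distrib-+ leaves enters ⟩
  ∑[ t < n ] leaves t + ∑[ t < n ] enters t   ≤⟨ +-mono-≤ (leaves-once π a) (enters-once π a) ⟩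
  2                                           ∎
  where
  open ≤-Reasoning
  leaves enters : Fin n → ℕ
  leaves t = 𝟙 (π ⟨$⟩ʳ t F.≟ a)
  enters t = 𝟙 (π ⟨$⟩ʳ cyc t F.≟ a)
  ends : ∀ t → Spends (a , b) π t → π ⟨$⟩ʳ t ≡ a ⊎ π ⟨$⟩ʳ cyc t ≡ a
  ends t (_ , inj₁ refl) = inj₁ refl
  ends t (_ , inj₂ refl) = inj₂ refl
  per-step : ∀ t → 𝟙 (spends? (a , b) π t) ≤ leaves t + enters t
  per-step t = 𝟙-⊎ (spends? (a , b) π t) (π ⟨$⟩ʳ t F.≟ a) (π ⟨$⟩ʳ cyc t F.≟ a) (ends t)

fooling-step : (h : Fin n) (qs : List (Fin n × Fin n)) (π : Permutation′ n) (t : Fin n) →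
  fooling h qs (π ⟨$⟩ʳ t) (π ⟨$⟩ʳ cyc t) ≤
    1 + 𝟙 (suc (toℕ t) ≟ n) + ∑[ k < length qs ] 𝟙 (spends? (lookup qs k) π t)
fooling-step {n} h qs π t = case suc (toℕ t) <? n of λ
  { (no closing) → ≤-trans (hubMetric-≤2 h (heavy qs) u v) (≤-trans (s≤s (≤-reflexive (sym (𝟙-yes
                     (suc (toℕ t) ≟ n) (last-position t closing))))) (m≤m+n _ _))
  ; (yes path)   → ≤-trans (≤1+ (hubMetric-≤2 h (heavy qs) u v) (spent path)) (+-monoˡ-≤ _ (m≤m+n 1 _))
  }
  where
  u = π ⟨$⟩ʳ t
  v = π ⟨$⟩ʳ cyc t
  ≤1+ : ∀ {x y} → x ≤ 2 → (x ≡ 2 → 1 ≤ y) → x ≤ 1 + y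
  ≤1+ {0}                 _               _     = z≤n
  ≤1+ {1}                 _               _     = s≤s z≤n
  ≤1+ {2}                 _               x≡2⇒1≤y = s≤s (x≡2⇒1≤y refl)
  ≤1+ {suc (suc (suc _))} (s≤s (s≤s ())) _
  spent : suc (toℕ t) < n → fooling h qs u v ≡ 2 →
    1 ≤ ∑[ k < length qs ] 𝟙 (spends? (lookup qs k) π t)
  spent path d≡2 with fooling-2 h qs u v d≡2
  ... | k , joins = ≤-trans (≤-reflexive (sym (𝟙-yes (spends? (lookup qs k) π t) (path , joins))))
                            (term≤∑ (λ k → 𝟙 (spends? (lookup qs k) π t)) k)

fooling-tour : (h : Fin n) (qs : List (Fin n × Fin n)) (π : Permutation′ n) →
  tourLength (fooling h qs) π ≤ n + 1 + ∑[ k < length qs ] ∑[ t < n ] 𝟙 (spends? (lookup qs k) π t)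
fooling-tour {n} h qs π = begin
  tourLength (fooling h qs) π                       ≡⟨ tourLength≡∑ (fooling h qs) π ⟩
  ∑[ t < n ] fooling h qs (π ⟨$⟩ʳ t) (π ⟨$⟩ʳ cyc t) ≤⟨ ∑-mono _ _ (fooling-step h qs π) ⟩
  ∑[ t < n ] (1 + closing t + ∑[ k < q ] spent k t) ≡⟨ ∑-distrib-+ (λ t → 1 + closing t) _ ⟩
  ∑[ t < n ] (1 + closing t) + ∑[ t < n ] ∑[ k < q ] spent k t
      ≡⟨ cong₂ _+_ (∑-distrib-+ (λ _ → 1) closing) (∑-comm (λ t k → spent k t)) ⟩
  ∑[ t < n ] 1 + ∑[ t < n ] closing t + ∑[ k < q ] ∑[ t < n ] spent k t
      ≤⟨ +-monoˡ-≤ _ (+-mono-≤ (≤-reflexive (trans (∑-const n 1) (*-identityʳ n))) closing-once) ⟩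
  n + 1 + ∑[ k < q ] ∑[ t < n ] spent k t           ∎
  where
  open ≤-Reasoning
  q = length qs
  closing : Fin n → ℕ
  closing t = 𝟙 (suc (toℕ t) ≟ n)
  spent : Fin q → Fin n → ℕ
  spent k t = 𝟙 (spends? (lookup qs k) π t)
  closing-once : ∑[ t < n ] closing t ≤ 1
  closing-once = ∑-at-most-one closing 1 (λ t → 𝟙≤1 (suc (toℕ t) ≟ n)) λ t t′ p p′ →
    toℕ-injective (suc-injective (trans (𝟙-pos (suc (toℕ t) ≟ n) p) (sym (𝟙-pos (suc (toℕ t′) ≟ n) p′))))

%-absorbˡ : ∀ a b .{{_ : ℕ.NonZero n}} → (a % n + b) % n ≡ (a + b) % n
%-absorbˡ {n} a b = begin
  (a % n + b) % n         ≡⟨ %-distribˡ-+ (a % n) b n ⟩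
  (a % n % n + b % n) % n ≡⟨ cong (λ x → (x + b % n) % n) (m%n%n≡m%n a n) ⟩
  (a % n + b % n) % n     ≡⟨ %-distribˡ-+ a b n ⟨
  (a + b) % n             ∎
  where open ≡-Reasoning

liftFin : (f : ℕ → ℕ) → (∀ x → x < n → f x < n) → Fin n → Fin n
liftFin f f< x = fromℕ< (f< (toℕ x) (toℕ<n x))

toℕ-liftFin : (f : ℕ → ℕ) (f< : ∀ x → x < n → f x < n) (x : Fin n) →
  toℕ (liftFin f f< x) ≡ f (toℕ x)
toℕ-liftFin f f< x = toℕ-fromℕ< (f< (toℕ x) (toℕ<n x))

ℕ-permutation : (f g : ℕ → ℕ) → (∀ x → x < n → f x < n) → (∀ x → x < n → g x < n) →
  (∀ x → x < n → f (g x) ≡ x) → (∀ x → x < n → g (f x) ≡ x) → Permutation′ n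
ℕ-permutation {n} f g f< g< fg gf =
  permutation (liftFin f f<) (liftFin g g<) (inverse f g f< g< fg) (inverse g f g< f< gf)
  where
  inverse : (f g : ℕ → ℕ) (f< : ∀ x → x < n → f x < n) (g< : ∀ x → x < n → g x < n) →
    (∀ x → x < n → f (g x) ≡ x) → ∀ x → liftFin f f< (liftFin g g< x) ≡ x
  inverse f g f< g< fg x = toℕ-injective (begin
    toℕ (liftFin f f< (liftFin g g< x)) ≡⟨ toℕ-liftFin f f< (liftFin g g< x) ⟩
    f (toℕ (liftFin g g< x))            ≡⟨ cong f (toℕ-liftFin g g< x) ⟩
    f (g (toℕ x))                       ≡⟨ fg (toℕ x) (toℕ<n x) ⟩
    toℕ x                               ∎)
    where open ≡-Reasoning

data Parity : ℕ → Set where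
  even : ∀ s → Parity (s * 2)
  odd  : ∀ s → Parity (1 + s * 2)

parity : ∀ t → Parity t
parity zero = even 0
parity (suc t) with parity t
... | even s = odd s
... | odd  s = even (suc s)

double : ∀ s → s * 2 ≡ s + s
double = solve-∀

even-%2 : ∀ s → s * 2 % 2 ≡ 0
even-%2 s = m*n%n≡0 s 2

odd-%2 : ∀ s → (1 + s * 2) % 2 ≡ 1
odd-%2 s = [m+kn]%n≡m%n 1 s 2

even-/2 : ∀ s → s * 2 / 2 ≡ s
even-/2 s = m*n/n≡m s 2

odd-/2 : ∀ s → (1 + s * 2) / 2 ≡ s
odd-/2 s = trans (+-distrib-/-∣ʳ 1 {d = 2} (n∣m*n s)) (m*n/n≡m s 2)

-- Write n = 1 + n′.  The zigzag lists
-- 0, n′, 1, n′-1, 2, … : position 2s holds s and position 2s+1 holds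
-- n′ - s, so consecutive entries add up to n′ or n.  The tour W_j is the
-- zigzag rotated by j.  For j < ⌊n/2⌋, consecutive entries of W_j add
-- up to 2j - 1 or 2j modulo n, so every path step of W_j has colour j
-- (see 'colour'), and a pair of points is a path step of at most one
-- of these tours.
module Walecki (n′ : ℕ) where

  N : ℕ
  N = suc n′

  zig : ℕ → ℕ
  zig t with t % 2
  ... | 0 = t / 2
  ... | _ = n′ ∸ t / 2

  zig-even : ∀ s → zig (s * 2) ≡ s
  zig-even s rewrite even-%2 s = even-/2 s

  zig-odd : ∀ s → zig (1 + s * 2) ≡ n′ ∸ s
  zig-odd s rewrite odd-%2 s = cong (n′ ∸_) (odd-/2 s)

  unzig : ℕ → ℕ
  unzig x with x * 2 ≤? n′
  ... | yes _ = x * 2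
  ... | no  _ = 1 + (n′ ∸ x) * 2

  unzig-small : ∀ x → x * 2 ≤ n′ → unzig x ≡ x * 2
  unzig-small x small with x * 2 ≤? n′
  ... | yes _     = refl
  ... | no  large = contradiction small large

  unzig-large : ∀ x → ¬ x * 2 ≤ n′ → unzig x ≡ 1 + (n′ ∸ x) * 2
  unzig-large x large with x * 2 ≤? n′
  ... | yes small = contradiction small large
  ... | no  _     = refl

  zig-≤ : ∀ t → t ≤ n′ → zig t ≤ n′
  zig-≤ t t≤n′ with parity t
  ... | even s rewrite zig-even s = ≤-trans (m≤m*n s 2) t≤n′
  ... | odd  s rewrite zig-odd s  = m∸n≤m n′ s

  unzig-≤ : ∀ x → x ≤ n′ → unzig x ≤ n′
  unzig-≤ x x≤n′ with x * 2 ≤? n′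
  ... | yes small = small
  ... | no  large = begin
    1 + k * 2   ≡⟨ cong suc (double k) ⟩
    suc (k + k) ≤⟨ +-monoˡ-≤ k k<x ⟩
    x + k       ≡⟨ +-comm x k ⟩
    k + x       ≡⟨ m∸n+n≡m x≤n′ ⟩
    n′          ∎
    where
    open ≤-Reasoning
    k = n′ ∸ x
    k<x : k < x
    k<x = +-cancelʳ-< x k x (begin-strict
      k + x ≡⟨ m∸n+n≡m x≤n′ ⟩
      n′    <⟨ ≰⇒> large ⟩
      x * 2 ≡⟨ double x ⟩
      x + x ∎)

  zig-unzig : ∀ x → x ≤ n′ → zig (unzig x) ≡ x
  zig-unzig x x≤n′ = case x * 2 ≤? n′ of λ
    { (yes small) → trans (cong zig (unzig-small x small)) (zig-even x)
    ; (no  large) → begin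
        zig (unzig x)           ≡⟨ cong zig (unzig-large x large) ⟩
        zig (1 + (n′ ∸ x) * 2)  ≡⟨ zig-odd (n′ ∸ x) ⟩
        n′ ∸ (n′ ∸ x)           ≡⟨ m∸[m∸n]≡n x≤n′ ⟩
        x                       ∎
    }
    where open ≡-Reasoning

  unzig-zig : ∀ t → t ≤ n′ → unzig (zig t) ≡ t
  unzig-zig t t≤n′ with parity t
  ... | even s = trans (cong unzig (zig-even s)) (unzig-small s t≤n′)
  ... | odd  s = begin
    unzig (zig (1 + s * 2))     ≡⟨ cong unzig (zig-odd s) ⟩
    unzig k                     ≡⟨ unzig-large k large ⟩
    1 + (n′ ∸ k) * 2            ≡⟨ cong (λ x → 1 + x * 2) (m∸[m∸n]≡n s≤n′) ⟩
    1 + s * 2                   ∎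
    where
    open ≡-Reasoning
    k = n′ ∸ s
    s≤n′ : s ≤ n′
    s≤n′ = ≤-trans (m≤m*n s 2) (≤-trans (n≤1+n _) t≤n′)
    k+s≡n′ : k + s ≡ n′
    k+s≡n′ = m∸n+n≡m s≤n′
    s<k : s < k
    s<k = +-cancelʳ-≤ s (suc s) k (subst (suc s + s ≤_) (sym k+s≡n′)
            (subst (_≤ n′) (cong suc (double s)) t≤n′))
    large : ¬ k * 2 ≤ n′
    large k*2≤n′ = <⇒≱ s<k (+-cancelˡ-≤ k k s (subst₂ _≤_ (double k) (sym k+s≡n′) k*2≤n′))

  zig-step : ∀ t → suc t ≤ n′ → zig t + zig (suc t) ≡ n′ ⊎ zig t + zig (suc t) ≡ N
  zig-step t t<n′ with parity t
  ... | even s rewrite zig-even s | zig-odd s = inj₁ (m+[n∸m]≡n s≤n′)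
    where
    s≤n′ : s ≤ n′
    s≤n′ = ≤-trans (m≤m*n s 2) (≤-trans (n≤1+n _) t<n′)
  ... | odd  s rewrite zig-odd s | zig-even (suc s) =
    inj₂ (trans (+-suc (n′ ∸ s) s) (cong suc (m∸n+n≡m s≤n′)))
    where
    s≤n′ : s ≤ n′
    s≤n′ = ≤-trans (m≤m*n s 2) (≤-trans (n≤1+n _) (≤-trans (n≤1+n _) t<n′))

  zig<N : ∀ t → t < N → zig t < N
  zig<N t t<N = s≤s (zig-≤ t (ℕ.s≤s⁻¹ t<N))

  zigzag : Permutation′ N
  zigzag = ℕ-permutation zig unzig zig<N
    (λ x x<N → s≤s (unzig-≤ x (ℕ.s≤s⁻¹ x<N)))
    (λ x x<N → zig-unzig x (ℕ.s≤s⁻¹ x<N))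
    (λ t t<N → unzig-zig t (ℕ.s≤s⁻¹ t<N))

  rotate : ℕ → ℕ → ℕ
  rotate a x = (a + x) % N

  rotate<N : ∀ a x → x < N → rotate a x < N
  rotate<N a x _ = m%n<n (a + x) N

  rotate-back : ∀ a b → a + b ≡ N → ∀ x → x < N → rotate b (rotate a x) ≡ x
  rotate-back a b a+b≡N x x<N = begin
    (b + (a + x) % N) % N   ≡⟨ cong (_% N) (+-comm b _) ⟩
    ((a + x) % N + b) % N   ≡⟨ %-absorbˡ (a + x) b ⟩
    (a + x + b) % N         ≡⟨ cong (_% N) (trans (regroup a x b) (cong (x +_) a+b≡N)) ⟩
    (x + N) % N             ≡⟨ [m+n]%n≡m%n x N ⟩
    x % N                   ≡⟨ m<n⇒m%n≡m x<N ⟩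
    x                       ∎
    where
    open ≡-Reasoning
    regroup : ∀ a x b → a + x + b ≡ x + (a + b)
    regroup = solve-∀

  rotation : (a b : ℕ) → a + b ≡ N → Permutation′ N
  rotation a b a+b≡N = ℕ-permutation (rotate a) (rotate b) (rotate<N a) (rotate<N b)
    (rotate-back b a (trans (+-comm b a) a+b≡N)) (rotate-back a b a+b≡N)

  m : ℕ
  m = N / 2

  m*2≤N : m * 2 ≤ N
  m*2≤N = m/n*n≤m N 2

  N≤m*2+1 : N ≤ m * 2 + 1
  N≤m*2+1 = begin
    N               ≡⟨ m≡m%n+[m/n]*n N 2 ⟩
    N % 2 + m * 2   ≤⟨ +-monoˡ-≤ (m * 2) (ℕ.s≤s⁻¹ (m%n<n N 2)) ⟩
    1 + m * 2       ≡⟨ +-comm 1 (m * 2) ⟩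
    m * 2 + 1       ∎
    where open ≤-Reasoning

  walecki : Fin m → Permutation′ N
  walecki j = zigzag ∘ₚ rotation (toℕ j) (N ∸ toℕ j) (m+[n∸m]≡n j≤N)
    where
    j≤N : toℕ j ≤ N
    j≤N = ≤-trans (<⇒≤ (toℕ<n j)) (m/n≤m N 2)

  walecki-at : ∀ j t → toℕ (walecki j ⟨$⟩ʳ t) ≡ rotate (toℕ j) (zig (toℕ t))
  walecki-at j t = trans (toℕ-liftFin (rotate (toℕ j)) (rotate<N (toℕ j)) (zigzag ⟨$⟩ʳ t))
                         (cong (rotate (toℕ j)) (toℕ-liftFin zig zig<N t))

  colour : Fin N → Fin N → ℕ
  colour u v = ((toℕ u + toℕ v + 1) % N) / 2

  colour-sym : ∀ u v → colour u v ≡ colour v u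
  colour-sym u v = cong (λ x → ((x + 1) % N) / 2) (+-comm (toℕ u) (toℕ v))

  %-sum+1 : ∀ a b → (a % N + b % N + 1) % N ≡ (a + b + 1) % N
  %-sum+1 a b = begin
    (a % N + b % N + 1) % N   ≡⟨ cong (_% N) (+-assoc (a % N) (b % N) 1) ⟩
    (a % N + (b % N + 1)) % N ≡⟨ %-absorbˡ a (b % N + 1) ⟩
    (a + (b % N + 1)) % N     ≡⟨ cong (_% N) (swap a (b % N)) ⟩
    (b % N + (a + 1)) % N     ≡⟨ %-absorbˡ b (a + 1) ⟩
    (b + (a + 1)) % N         ≡⟨ cong (_% N) (swap b a) ⟩
    (a + (b + 1)) % N         ≡⟨ cong (_% N) (sym (+-assoc a b 1)) ⟩
    (a + b + 1) % N           ∎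
    where
    open ≡-Reasoning
    swap : ∀ x y → x + (y + 1) ≡ y + (x + 1)
    swap = solve-∀

  walecki-colour : ∀ j t → suc (toℕ t) < N →
    colour (walecki j ⟨$⟩ʳ t) (walecki j ⟨$⟩ʳ cyc t) ≡ toℕ j
  walecki-colour j t path = begin
    colour (walecki j ⟨$⟩ʳ t) (walecki j ⟨$⟩ʳ cyc t)
      ≡⟨ cong₂ (λ x y → ((x + y + 1) % N) / 2) (walecki-at j t)
               (trans (walecki-at j (cyc t)) (cong (rotate c ∘ zig) (toℕ-cyc t path))) ⟩
    ((rotate c z₁ + rotate c z₂ + 1) % N) / 2  ≡⟨ cong (_/ 2) (%-sum+1 (c + z₁) (c + z₂)) ⟩
    ((c + z₁ + (c + z₂) + 1) % N) / 2          ≡⟨ cong (λ x → (x % N) / 2) (regroup c z₁ z₂) ⟩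
    ((c * 2 + (z₁ + z₂) + 1) % N) / 2          ≡⟨ by-step (zig-step (toℕ t) (ℕ.s≤s⁻¹ path)) ⟩
    c                                          ∎
    where
    open ≡-Reasoning
    c  = toℕ j
    z₁ = zig (toℕ t)
    z₂ = zig (suc (toℕ t))
    regroup : ∀ c z₁ z₂ → c + z₁ + (c + z₂) + 1 ≡ c * 2 + (z₁ + z₂) + 1
    regroup = solve-∀
    -- 2c + 2 ≤ N because c < ⌊N/2⌋
    c*2<N : 1 + c * 2 < N
    c*2<N = ≤-trans (*-monoˡ-≤ 2 (toℕ<n j)) (m/n*n≤m N 2)
    even-residue : (c * 2 + N) % N ≡ c * 2
    even-residue = trans ([m+n]%n≡m%n (c * 2) N) (m<n⇒m%n≡m (<-trans (n<1+n _) c*2<N))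
    odd-residue : (1 + c * 2 + N) % N ≡ 1 + c * 2
    odd-residue = trans ([m+n]%n≡m%n (1 + c * 2) N) (m<n⇒m%n≡m c*2<N)
    by-step : z₁ + z₂ ≡ n′ ⊎ z₁ + z₂ ≡ N → ((c * 2 + (z₁ + z₂) + 1) % N) / 2 ≡ c
    by-step (inj₁ sum≡n′) = begin
      ((c * 2 + (z₁ + z₂) + 1) % N) / 2 ≡⟨ cong (λ x → ((c * 2 + x + 1) % N) / 2) sum≡n′ ⟩
      ((c * 2 + n′ + 1) % N) / 2        ≡⟨ cong (λ x → (x % N) / 2) (+-assoc (c * 2) n′ 1) ⟩
      ((c * 2 + (n′ + 1)) % N) / 2      ≡⟨ cong (λ x → ((c * 2 + x) % N) / 2) (+-comm n′ 1) ⟩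
      ((c * 2 + N) % N) / 2             ≡⟨ cong (_/ 2) even-residue ⟩
      c * 2 / 2                         ≡⟨ even-/2 c ⟩
      c                                 ∎
    by-step (inj₂ sum≡N) = begin
      ((c * 2 + (z₁ + z₂) + 1) % N) / 2 ≡⟨ cong (λ x → ((c * 2 + x + 1) % N) / 2) sum≡N ⟩
      ((c * 2 + N + 1) % N) / 2         ≡⟨ cong (λ x → (x % N) / 2) (+-comm (c * 2 + N) 1) ⟩
      ((1 + c * 2 + N) % N) / 2         ≡⟨ cong (_/ 2) odd-residue ⟩
      (1 + c * 2) / 2                   ≡⟨ odd-/2 c ⟩
      c                                 ∎

  spends-colour : ∀ e j t → Spends e (walecki j) t → colour (proj₁ e) (proj₂ e) ≡ toℕ j
  spends-colour e j t (path , inj₁ refl) = walecki-colour j t path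
  spends-colour e j t (path , inj₂ refl) =
    trans (colour-sym (walecki j ⟨$⟩ʳ cyc t) (walecki j ⟨$⟩ʳ t)) (walecki-colour j t path)

  -- Together the Walecki tours spend any query at most twice: only the
  -- tour whose index is its colour can spend it.
  walecki-spends : (e : Fin N × Fin N) → ∑[ j < m ] ∑[ t < N ] 𝟙 (spends? e (walecki j) t) ≤ 2
  walecki-spends e = ∑-at-most-one _ 2 (λ j → spends-at-most-twice e (walecki j))
    λ j j′ p p′ → toℕ-injective (trans (sym (colour-of j p)) (colour-of j′ p′))
    where
    colour-of : ∀ j → 0 < ∑[ t < N ] 𝟙 (spends? e (walecki j) t) → colour (proj₁ e) (proj₂ e) ≡ toℕ j
    colour-of j pos with ∑-pos _ pos
    ... | t , spent = spends-colour e j t (𝟙-pos (spends? e (walecki j) t) spent)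

  walecki-total : (h : Fin N) (qs : List (Fin N × Fin N)) →
    ∑[ j < m ] tourLength (fooling h qs) (walecki j) ≤ m * (N + 1) + length qs * 2
  walecki-total h qs = begin
    ∑[ j < m ] tourLength (fooling h qs) (walecki j)
      ≤⟨ ∑-mono _ _ (λ j → fooling-tour h qs (walecki j)) ⟩
    ∑[ j < m ] (N + 1 + ∑[ k < q ] spent k j)
      ≡⟨ ∑-distrib-+ (λ _ → N + 1) (λ j → ∑[ k < q ] spent k j) ⟩
    ∑[ j < m ] (N + 1) + ∑[ j < m ] ∑[ k < q ] spent k j
      ≡⟨ cong₂ _+_ (∑-const m (N + 1)) (∑-comm (λ j k → spent k j)) ⟩
    m * (N + 1) + ∑[ k < q ] ∑[ j < m ] spent k j
      ≤⟨ +-monoʳ-≤ (m * (N + 1)) (∑-mono _ _ (λ k → walecki-spends (lookup qs k))) ⟩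
    m * (N + 1) + ∑[ k < q ] 2
      ≡⟨ cong (m * (N + 1) +_) (∑-const q 2) ⟩
    m * (N + 1) + q * 2 ∎
    where
    open ≤-Reasoning
    q = length qs
    spent : Fin q → Fin m → ℕ
    spent k j = ∑[ t < N ] 𝟙 (spends? (lookup qs k) (walecki j) t)

approximation-forces-queries : ∀ {R P n m q cs c′} →
  2 * n ≤ cs + 2 → n ≤ c′ → m * c′ ≤ m * (n + 1) + q * 2 →
  cs * R + P * c′ ≤ 2 * R * c′ → m * P * n ≤ 4 * R * (m + q)
approximation-forces-queries {R} {P} {n} {m} {q} {cs} {c′} star-cost fool-cost walecki-cost approx =
  begin
    m * P * n     ≤⟨ *-monoʳ-≤ (m * P) fool-cost ⟩
    m * P * c′    ≤⟨ +-cancelʳ-≤ (2 * R * m * n) (m * P * c′) (4 * R * (m + q))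
                       (subst (m * P * c′ + 2 * R * m * n ≤_) (+-comm (2 * R * m * n) _) scaled) ⟩
    4 * R * (m + q) ∎
  where
  open ≤-Reasoning
  unscaled : P * c′ + R * (2 * n) ≤ 2 * R * c′ + 2 * R
  unscaled = begin
    P * c′ + R * (2 * n)    ≤⟨ +-monoʳ-≤ (P * c′) (*-monoʳ-≤ R star-cost) ⟩
    P * c′ + R * (cs + 2)   ≡⟨ regroup P c′ R cs ⟩
    cs * R + P * c′ + 2 * R ≤⟨ +-monoˡ-≤ (2 * R) approx ⟩
    2 * R * c′ + 2 * R      ∎
    where
    regroup : ∀ P c′ R cs → P * c′ + R * (cs + 2) ≡ cs * R + P * c′ + 2 * R
    regroup = solve-∀
  scaled : m * P * c′ + 2 * R * m * n ≤ 2 * R * m * n + 4 * R * (m + q)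
  scaled = begin
    m * P * c′ + 2 * R * m * n              ≡⟨ e₁ m P c′ R n ⟩
    m * (P * c′ + R * (2 * n))              ≤⟨ *-monoʳ-≤ m unscaled ⟩
    m * (2 * R * c′ + 2 * R)                ≡⟨ e₂ m R c′ ⟩
    2 * R * (m * c′) + 2 * R * m            ≤⟨ +-monoˡ-≤ (2 * R * m) (*-monoʳ-≤ (2 * R) walecki-cost) ⟩
    2 * R * (m * (n + 1) + q * 2) + 2 * R * m ≡⟨ e₃ R m n q ⟩
    2 * R * m * n + 4 * R * (m + q)         ∎
    where
    e₁ : ∀ m P c′ R n → m * P * c′ + 2 * R * m * n ≡ m * (P * c′ + R * (2 * n))
    e₁ = solve-∀
    e₂ : ∀ m R c′ → m * (2 * R * c′ + 2 * R) ≡ 2 * R * (m * c′) + 2 * R * m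
    e₂ = solve-∀
    e₃ : ∀ R m n q → 2 * R * (m * (n + 1) + q * 2) + 2 * R * m ≡ 2 * R * m * n + 4 * R * (m + q)
    e₃ = solve-∀

few-queries-impossible : ∀ {R P n m q} → 1 ≤ P → 8 * R + 2 ≤ n → n ≤ m * 2 + 1 → m * 2 ≤ n →
  m * P * n ≤ 4 * R * (m + q) → q * (16 * R) < P * (n * n) → ⊥
few-queries-impossible {R} {P} {n} {m} {q} 1≤P n-large n≤2m+1 2m≤n forced few =
  <-irrefl refl (<-≤-trans Pn<8R+2P 8R+2P≤Pn)
  where
  open ≤-Reasoning
  twice : P * (n * n) + P * (n * n) < P * (n * n) + (16 * R * m + 2 * P * n)
  twice = begin-strict
    P * (n * n) + P * (n * n)           ≡⟨ e₁ P n ⟩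
    2 * (P * n * n)                     ≤⟨ *-monoʳ-≤ 2 (*-monoʳ-≤ (P * n) n≤2m+1) ⟩
    2 * (P * n * (m * 2 + 1))           ≡⟨ e₂ P n m ⟩
    4 * (m * P * n) + 2 * P * n         ≤⟨ +-monoˡ-≤ (2 * P * n) (*-monoʳ-≤ 4 forced) ⟩
    4 * (4 * R * (m + q)) + 2 * P * n   ≡⟨ e₃ R m q P n ⟩
    16 * R * m + 2 * P * n + q * (16 * R) <⟨ +-monoʳ-< (16 * R * m + 2 * P * n) few ⟩
    16 * R * m + 2 * P * n + P * (n * n) ≡⟨ +-comm _ (P * (n * n)) ⟩
    P * (n * n) + (16 * R * m + 2 * P * n) ∎
    where
    e₁ : ∀ P n → P * (n * n) + P * (n * n) ≡ 2 * (P * n * n)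
    e₁ = solve-∀
    e₂ : ∀ P n m → 2 * (P * n * (m * 2 + 1)) ≡ 4 * (m * P * n) + 2 * P * n
    e₂ = solve-∀
    e₃ : ∀ R m q P n → 4 * (4 * R * (m + q)) + 2 * P * n ≡ 16 * R * m + 2 * P * n + q * (16 * R)
    e₃ = solve-∀
  Pn<8R+2P : P * n < 8 * R + 2 * P
  Pn<8R+2P = *-cancelʳ-< n (P * n) (8 * R + 2 * P) (begin-strict
    P * n * n                ≡⟨ *-assoc P n n ⟩
    P * (n * n)              <⟨ +-cancelˡ-< (P * (n * n)) _ _ twice ⟩
    16 * R * m + 2 * P * n   ≡⟨ e₄ R m P n ⟩
    8 * R * (m * 2) + 2 * P * n ≤⟨ +-monoˡ-≤ (2 * P * n) (*-monoʳ-≤ (8 * R) 2m≤n) ⟩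
    8 * R * n + 2 * P * n    ≡⟨ e₅ R P n ⟩
    (8 * R + 2 * P) * n      ∎)
    where
    e₄ : ∀ R m P n → 16 * R * m + 2 * P * n ≡ 8 * R * (m * 2) + 2 * P * n
    e₄ = solve-∀
    e₅ : ∀ R P n → 8 * R * n + 2 * P * n ≡ (8 * R + 2 * P) * n
    e₅ = solve-∀
  8R+2P≤Pn : 8 * R + 2 * P ≤ P * n
  8R+2P≤Pn = begin
    8 * R + 2 * P            ≡⟨ cong (_+ 2 * P) (*-identityʳ (8 * R)) ⟨
    8 * R * 1 + 2 * P        ≤⟨ +-monoˡ-≤ (2 * P) (*-monoʳ-≤ (8 * R) 1≤P) ⟩
    8 * R * P + 2 * P        ≡⟨ e₆ R P ⟩
    P * (8 * R + 2)          ≤⟨ *-monoʳ-≤ P n-large ⟩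
    P * n                    ∎
    where
    e₆ : ∀ R P → 8 * R * P + 2 * P ≡ P * (8 * R + 2)
    e₆ = solve-∀

κ : ℚ
κ = ℤ.+ 1 Q./ 16

module FractionBounds (p′ r′ : ℕ) .(coprime : Coprime (suc p′) (suc r′)) where
  open ℤ using (+_; +[1+_])

  toℚᵘ-ℕ→ℚ : ∀ k → toℚᵘ (ℕ→ℚ k) U.≃ mkℚᵘ (+ k) 0
  toℚᵘ-ℕ→ℚ k = toℚᵘ-fromℚᵘ (mkℚᵘ (+ k) 0)

  P R : ℕ
  P = suc p′
  R = suc r′

  ε : ℚ
  ε = mkℚ +[1+ p′ ] r′ coprime

  approx-in-ℕ : ∀ a b → ℕ→ℚ a Q.≤ (ℕ→ℚ 2 Q.- ε) Q.* ℕ→ℚ b → a * R + P * b ≤ 2 * R * b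
  approx-in-ℕ a b a≤ with UP.≤-respʳ-≃ rhs (UP.≤-respˡ-≃ (toℚᵘ-ℕ→ℚ a) (toℚᵘ-mono-≤ a≤))
    where
    rhs : toℚᵘ ((ℕ→ℚ 2 Q.- ε) Q.* ℕ→ℚ b) U.≃ (mkℚᵘ (+ 2) 0 U.- mkℚᵘ (+ P) r′) U.* mkℚᵘ (+ b) 0
    rhs = UP.≃-trans (toℚᵘ-homo-* (ℕ→ℚ 2 Q.- ε) (ℕ→ℚ b))
            (UP.*-cong (UP.≃-trans (toℚᵘ-homo-+ (ℕ→ℚ 2) (Q.- ε))
                                   (UP.+-cong (toℚᵘ-ℕ→ℚ 2) (toℚᵘ-homo‿- ε)))
                       (toℚᵘ-ℕ→ℚ b))
  ... | *≤* a≤[2-ε]b = ℤP.drop‿+≤+ (subst₂ ℤ._≤_ lhs≡ rhs≡ (ℤP.+-monoˡ-≤ (+ P ℤ.* + b) ℤ-form))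
    where
    ℤ-form : + a ℤ.* + (1 * R * 1) ℤ.≤ ((+ 2 ℤ.* + R ℤ.+ (ℤ.- + P) ℤ.* + 1) ℤ.* + b) ℤ.* + 1
    ℤ-form = a≤[2-ε]b
    lhs≡ : + a ℤ.* + (1 * R * 1) ℤ.+ + P ℤ.* + b ≡ + (a * R + P * b)
    lhs≡ = begin
      + a ℤ.* + (1 * R * 1) ℤ.+ + P ℤ.* + b ≡⟨ cong (λ x → + a ℤ.* + x ℤ.+ + P ℤ.* + b) (*-identityʳ (1 * R)) ⟩
      + a ℤ.* + (1 * R) ℤ.+ + P ℤ.* + b     ≡⟨ cong (λ x → + a ℤ.* + x ℤ.+ + P ℤ.* + b) (*-identityˡ R) ⟩
      + a ℤ.* + R ℤ.+ + P ℤ.* + b           ≡⟨ cong₂ ℤ._+_ (ℤP.pos-* a R) (ℤP.pos-* P b) ⟨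
      + (a * R) ℤ.+ + (P * b)               ≡⟨ ℤP.pos-+ (a * R) (P * b) ⟨
      + (a * R + P * b)                     ∎
      where open ≡-Reasoning
    rhs≡ : ((+ 2 ℤ.* + R ℤ.+ (ℤ.- + P) ℤ.* + 1) ℤ.* + b) ℤ.* + 1 ℤ.+ + P ℤ.* + b ≡ + (2 * R * b)
    rhs≡ = begin
      ((+ 2 ℤ.* + R ℤ.+ (ℤ.- + P) ℤ.* + 1) ℤ.* + b) ℤ.* + 1 ℤ.+ + P ℤ.* + b ≡⟨ cancel (+ R) (+ P) (+ b) ⟩
      + 2 ℤ.* + R ℤ.* + b                                               ≡⟨ cong (ℤ._* + b) (ℤP.pos-* 2 R) ⟨
      + (2 * R) ℤ.* + b                                                 ≡⟨ ℤP.pos-* (2 * R) b ⟨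
      + (2 * R * b)                                                     ∎
      where
      open ≡-Reasoning
      cancel : ∀ R P b → ((+ 2 ℤ.* R ℤ.+ (ℤ.- P) ℤ.* + 1) ℤ.* b) ℤ.* + 1 ℤ.+ P ℤ.* b ≡ + 2 ℤ.* R ℤ.* b
      cancel = ℤ-Solver.solve-∀

  few-queries-in-ℕ : ∀ N q → ¬ (κ Q.* ε Q.* ℕ→ℚ N Q.≤ ℕ→ℚ q) → q * (16 * R) < P * N
  few-queries-in-ℕ N q q≱ with UP.<-respʳ-≃ rhs (UP.<-respˡ-≃ (toℚᵘ-ℕ→ℚ q) (toℚᵘ-mono-< (ℚP.≰⇒> q≱)))
    where
    rhs : toℚᵘ (κ Q.* ε Q.* ℕ→ℚ N) U.≃ mkℚᵘ (+ 1) 15 U.* mkℚᵘ (+ P) r′ U.* mkℚᵘ (+ N) 0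
    rhs = UP.≃-trans (toℚᵘ-homo-* (κ Q.* ε) (ℕ→ℚ N))
            (UP.*-cong (toℚᵘ-homo-* κ ε) (toℚᵘ-ℕ→ℚ N))
  ... | *<* q<κεN = ℤP.drop‿+<+ (subst₂ ℤ._<_ lhs≡ rhs≡ ℤ-form)
    where
    ℤ-form : + q ℤ.* + (16 * R * 1) ℤ.< ((+ 1 ℤ.* + P) ℤ.* + N) ℤ.* + 1
    ℤ-form = q<κεN
    lhs≡ : + q ℤ.* + (16 * R * 1) ≡ + (q * (16 * R))
    lhs≡ = trans (cong (λ x → + q ℤ.* + x) (*-identityʳ (16 * R))) (sym (ℤP.pos-* q (16 * R)))
    rhs≡ : ((+ 1 ℤ.* + P) ℤ.* + N) ℤ.* + 1 ≡ + (P * N)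
    rhs≡ = trans (ℤP.*-identityʳ _) (trans (cong (ℤ._* + N) (ℤP.*-identityˡ (+ P))) (sym (ℤP.pos-* P N)))

module _ (Class : ∀ {n} → Dist n → Set)
         (hub-in-class : ∀ {n} (h : Fin n) (heavy : Fin n → Fin n → Bool) → Class (hubMetric h heavy))
         where

  -- Let ε = P/R and N ≥ 8R + 2.  An algorithm that (2 - ε)-approximates
  -- the cost on the class makes at least κ ε N² queries on the star
  -- metric: otherwise it answers the same on the fooling metric of its
  -- queries, whose cost is too small for that answer.
  star-needs-queries : (p′ r′ : ℕ) .(coprime : Coprime (suc p′) (suc r′)) (n′ : ℕ) →
    8 * suc r′ + 2 ≤ suc n′ → (A : QueryAlg (suc n′)) →
    Approximates Class (ℕ→ℚ 2 Q.- FractionBounds.ε p′ r′ coprime) A →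
    ¬ ¬ (κ Q.* FractionBounds.ε p′ r′ coprime Q.* ℕ→ℚ (suc n′ * suc n′)
           Q.≤ ℕ→ℚ (queries A (starMetric F.zero)))
  star-needs-queries p′ r′ coprime n′ N-large A approx few =
    tsp-cost-exists star λ (cs , star-cost) →
    tsp-cost-exists fool λ (c′ , fool-cost) →
    few-queries-impossible {R} {P} {N} {m} {queries A star} (s≤s z≤n) N-large N≤m*2+1 m*2≤N
      (approximation-forces-queries {R} {P} {N} {m} (star-lower star-cost) (fool-lower fool-cost)
        (fool-upper fool-cost) (approx-in-ℕ cs c′ (same-answer star-cost fool-cost)))
      (few-queries-in-ℕ (N * N) (queries A star) few)
    where
    open Walecki n′
    open FractionBounds p′ r′ coprime
    star fool : Dist N
    star = starMetric F.zero
    fool = fooling F.zero (transcript A star)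

    2≤N : 2 ≤ N
    2≤N = ≤-trans (m≤n+m 2 (8 * R)) N-large

    star-lower : ∀ {cs} → IsTSPCost star cs → 2 * N ≤ cs + 2
    star-lower ((π , refl) , _) = star-tour 2≤N F.zero π

    fool-lower : ∀ {c′} → IsTSPCost fool c′ → N ≤ c′
    fool-lower ((π , refl) , _) = tour-≥n 2≤N fool (hubMetric-≥1 F.zero _) π

    -- the cost is at most the average length of the Walecki tours
    fool-upper : ∀ {c′} → IsTSPCost fool c′ → m * c′ ≤ m * (N + 1) + queries A star * 2
    fool-upper {c′} (_ , optimal) = begin
      m * c′                                  ≡⟨ ∑-const m c′ ⟨
      ∑[ j < m ] c′                           ≤⟨ ∑-mono _ _ (λ j → optimal (walecki j)) ⟩
      ∑[ j < m ] tourLength fool (walecki j)  ≤⟨ walecki-total F.zero (transcript A star) ⟩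
      m * (N + 1) + length (transcript A star) * 2
                                              ≡⟨ cong (λ q → m * (N + 1) + q * 2) (transcript-length A star) ⟩
      m * (N + 1) + queries A star * 2        ∎
      where open ≤-Reasoning

    same-answer : ∀ {cs c′} → IsTSPCost star cs → IsTSPCost fool c′ →
      ℕ→ℚ cs Q.≤ (ℕ→ℚ 2 Q.- ε) Q.* ℕ→ℚ c′
    same-answer {cs} {c′} star-cost fool-cost = ℚP.≤-trans
      (proj₁ (approx star (hub-in-class F.zero _) cs star-cost))
      (subst (Q._≤ (ℕ→ℚ 2 Q.- ε) Q.* ℕ→ℚ c′)
        (run-agree A star fool (fooling-agrees F.zero (transcript A star)))
        (proj₂ (approx fool (hub-in-class F.zero _) c′ fool-cost)))

  -- κ = 1/16; for ε = P/R the threshold is n₀ = 8R + 2 (ε > 0 excludes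
  -- the other forms of ε), and the hard instance is the star metric.
  lowerBound : QueryLowerBound Class
  lowerBound = κ , ℚP.positive⁻¹ _ , bound
    where
    bound : ∀ (ε : ℚ) → ℕ→ℚ 0 Q.< ε → ∃ λ (n₀ : ℕ) → ∀ n → n₀ ≤ n → ∀ (A : QueryAlg n) →
      Approximates Class (ℕ→ℚ 2 Q.- ε) A →
      ∃ λ (d : Dist n) → Class d × (κ Q.* ε Q.* ℕ→ℚ (n * n) Q.≤ ℕ→ℚ (queries A d))
    bound (mkℚ ℤ.+[1+ p′ ] r′ coprime) _ = 8 * suc r′ + 2 , λ
      { zero ()
      ; (suc n′) N-large A approx → starMetric F.zero , hub-in-class F.zero _ ,
          decidable-stable (_ Q.≤? _) (star-needs-queries p′ r′ coprime n′ N-large A approx)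
      }
    bound (mkℚ (ℤ.+ 0)       r′ _) ε>0 with () ← Q.positive ε>0
    bound (mkℚ ℤ.-[1+ p′ ]   r′ _) ε>0 with () ← Q.positive ε>0

mainTheorem14 : QueryLowerBound IsGraphicMetric × QueryLowerBound Is12Metric
mainTheorem14 = lowerBound IsGraphicMetric hubMetric-isGraphic , lowerBound Is12Metric hubMetric-is12
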